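{- Let $\Pi\,\phi\wedge L(u)$ be a true S-form DQBF, where $u$ is a universal variable of $\Pi$, $\phi$ and $L(u)$ are quantifier-free propositional formulas, and $L$ contains no existential variable $x$ with $u\in D_x$. Then the S-form DQBF $\Pi\,\phi\wedge L(u)\wedge L(0)$ is true, and the S-form DQBF $\Pi\,\phi\wedge L(u)\wedge L(1)$ is also true. Here $L(c)$ denotes $L$ with the constant $c$ substituted for $u$.
   Context: An S-form DQBF is a formula $\forall U\exists E\,\psi$ (with prefix written $\Pi$) where $U$ is a finite set of universal variables, $E$ a finite set of existential variables, each $x\in E$ carries a dependency set $D_x\subseteq U$ (quantifier order is irrelevant), and $\psi$ is a quantifier-free propositional formula over $U\cup E$. It is true iff there are functions $f_x:\{0,1\}^{D_x}\to\{0,1\}$ for $x\in E$ (Skolem functions) such that for every assignment $\tau$ to $U$, the assignment $\tau$ extended by $x\mapsto f_x(\tau|_{D_x})$ satisfies $\psi$. -}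

module Defs where

open import Data.Nat using (ℕ)
open import Data.Fin using (Fin; _≟_)
open import Data.Fin.Subset using (Subset; _∈_; _∉_)
open import Data.Bool using (Bool; true; false; not; _∧_; _∨_; if_then_else_)
open import Relation.Nullary using (yes; no)
open import Relation.Binary.PropositionalEquality using (_≡_)
open import Data.Product using (Σ; _×_)
open import Data.Unit using (⊤)

data Formula (nU nE : ℕ) : Set where
  const : Bool → Formula nU nE
  uvar  : Fin nU → Formula nU nE
  evar  : Fin nE → Formula nU nE
  ¬f    : Formula nU nE → Formula nU nE
  _∧f_  : Formula nU nE → Formula nU nE → Formula nU nE
  _∨f_  : Formula nU nE → Formula nU nE → Formula nU nE

eval : ∀ {nU nE} → (Fin nU → Bool) → (Fin nE → Bool) → Formula nU nE → Bool
eval τ σ (const b) = b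
eval τ σ (uvar i)  = τ i
eval τ σ (evar j)  = σ j
eval τ σ (¬f φ)    = not (eval τ σ φ)
eval τ σ (φ ∧f ψ)  = eval τ σ φ ∧ eval τ σ ψ
eval τ σ (φ ∨f ψ)  = eval τ σ φ ∨ eval τ σ ψ

-- An S-form DQBF prefix: dependency set D_x ⊆ U for each existential x.
Prefix : ℕ → ℕ → Set
Prefix nU nE = Fin nE → Subset nU

DependsOnlyOn : ∀ {nU} → Subset nU → ((Fin nU → Bool) → Bool) → Set
DependsOnlyOn D f = ∀ τ τ′ → (∀ i → i ∈ D → τ i ≡ τ′ i) → f τ ≡ f τ′

DQBFTrue : ∀ {nU nE} → Prefix nU nE → Formula nU nE → Set
DQBFTrue {nU} {nE} D ψ =
  Σ (Fin nE → (Fin nU → Bool) → Bool) λ f →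
    (∀ x → DependsOnlyOn (D x) (f x)) ×
    (∀ τ → eval τ (λ x → f x τ) ψ ≡ true)

subst-u : ∀ {nU nE} → Fin nU → Bool → Formula nU nE → Formula nU nE
subst-u u c (const b) = const b
subst-u u c (uvar i) with i ≟ u
... | yes _ = const c
... | no _  = uvar i
subst-u u c (evar j) = evar j
subst-u u c (¬f φ)   = ¬f (subst-u u c φ)
subst-u u c (φ ∧f ψ) = subst-u u c φ ∧f subst-u u c ψ
subst-u u c (φ ∨f ψ) = subst-u u c φ ∨f subst-u u c ψ

AllEvars : ∀ {nU nE} → (Fin nE → Set) → Formula nU nE → Set
AllEvars P (const _) = ⊤
AllEvars P (uvar _)  = ⊤
AllEvars P (evar j)  = P j
AllEvars P (¬f φ)    = AllEvars P φ
AllEvars P (φ ∧f ψ)  = AllEvars P φ × AllEvars P ψ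
AllEvars P (φ ∨f ψ)  = AllEvars P φ × AllEvars P ψ

-- Keep the Skolem functions of Π φ ∧ L(u). At an assignment τ, the value of L(c)
-- is the value of L at τ[u ≔ c]; the existentials occurring in L do not depend
-- on u, so they take the same values at τ and at τ[u ≔ c], where φ ∧ L holds.
module Submission where

open import Defs
open import Data.Fin using (Fin; _≟_)
open import Data.Fin.Subset using (Subset; _∈_; _∉_)
open import Data.Bool using (Bool; true; false; not; _∧_; _∨_)
open import Data.Bool.Properties using (∧-conicalʳ)
open import Data.Empty using (⊥-elim)
open import Data.Product using (_×_; _,_)
open import Relation.Nullary using (yes; no)
open import Relation.Binary.PropositionalEquality using (_≡_; refl; cong; cong₂; trans)

_[_≔_] : ∀ {n} → (Fin n → Bool) → Fin n → Bool → Fin n → Bool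
(τ [ u ≔ c ]) i with i ≟ u
... | yes _ = c
... | no  _ = τ i

eval-subst-u : ∀ {nU nE} (τ : Fin nU → Bool) (σ : Fin nE → Bool) u c (L : Formula nU nE) →
  eval τ σ (subst-u u c L) ≡ eval (τ [ u ≔ c ]) σ L
eval-subst-u τ σ u c (const b) = refl
eval-subst-u τ σ u c (uvar i) with i ≟ u
... | yes _ = refl
... | no  _ = refl
eval-subst-u τ σ u c (evar x)  = refl
eval-subst-u τ σ u c (¬f L)    = cong not (eval-subst-u τ σ u c L)
eval-subst-u τ σ u c (L ∧f M)  = cong₂ _∧_ (eval-subst-u τ σ u c L) (eval-subst-u τ σ u c M)
eval-subst-u τ σ u c (L ∨f M)  = cong₂ _∨_ (eval-subst-u τ σ u c L) (eval-subst-u τ σ u c M)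

eval-cong-evars : ∀ {nU nE} {P : Fin nE → Set} (τ : Fin nU → Bool) {σ σ′ : Fin nE → Bool}
  (L : Formula nU nE) → AllEvars P L → (∀ x → P x → σ x ≡ σ′ x) → eval τ σ L ≡ eval τ σ′ L
eval-cong-evars τ (const b) _ _ = refl
eval-cong-evars τ (uvar i)  _ _ = refl
eval-cong-evars τ (evar x)  Px σ≡σ′ = σ≡σ′ x Px
eval-cong-evars τ (¬f L) PL σ≡σ′ = cong not (eval-cong-evars τ L PL σ≡σ′)
eval-cong-evars τ (L ∧f M) (PL , PM) σ≡σ′ =
  cong₂ _∧_ (eval-cong-evars τ L PL σ≡σ′) (eval-cong-evars τ M PM σ≡σ′)
eval-cong-evars τ (L ∨f M) (PL , PM) σ≡σ′ =
  cong₂ _∨_ (eval-cong-evars τ L PL σ≡σ′) (eval-cong-evars τ M PM σ≡σ′)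

≔-agrees-outside : ∀ {n} (S : Subset n) (τ : Fin n → Bool) u c → u ∉ S →
  ∀ i → i ∈ S → τ i ≡ (τ [ u ≔ c ]) i
≔-agrees-outside S τ u c u∉S i i∈S with i ≟ u
... | yes refl = ⊥-elim (u∉S i∈S)
... | no  _    = refl

DQBFTrue-∧-subst-u : ∀ {nU nE} (D : Prefix nU nE) (φ L : Formula nU nE) (u : Fin nU) (c : Bool) →
  AllEvars (λ x → u ∉ D x) L →
  DQBFTrue D (φ ∧f L) →
  DQBFTrue D ((φ ∧f L) ∧f subst-u u c L)
DQBFTrue-∧-subst-u D φ L u c L⊥u (f , f-dep , f-sat) =
  f , f-dep , λ τ → cong₂ _∧_ (f-sat τ) (L[c]-holds τ)
  where
  L[c]-holds : ∀ τ → eval τ (λ x → f x τ) (subst-u u c L) ≡ true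
  L[c]-holds τ = trans (eval-subst-u τ _ u c L)
    (trans (eval-cong-evars (τ [ u ≔ c ]) L L⊥u
              (λ x u∉Dx → f-dep x τ (τ [ u ≔ c ]) (≔-agrees-outside (D x) τ u c u∉Dx)))
           (∧-conicalʳ _ _ (f-sat (τ [ u ≔ c ]))))

lemma1 : ∀ {nU nE} (D : Prefix nU nE) (φ L : Formula nU nE) (u : Fin nU) →
    AllEvars (λ x → u ∉ D x) L →
    DQBFTrue D (φ ∧f L) →
    DQBFTrue D ((φ ∧f L) ∧f subst-u u false L) × DQBFTrue D ((φ ∧f L) ∧f subst-u u true L)
lemma1 D φ L u L⊥u Πφ∧L =
  DQBFTrue-∧-subst-u D φ L u false L⊥u Πφ∧L , DQBFTrue-∧-subst-u D φ L u true L⊥u Πφ∧L
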